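{- Let $\mathsf{G}(\mathbf{KT_n})$ be the sequent calculus described in the context; all formulas are in $\mathcal{L}^1$. (Pre-interpolants.) For any formula $B(\overrightarrow{q},\overrightarrow{r})$, where the variables in $\overrightarrow{q}$ are all different from those in $\overrightarrow{r}$, there exists a formula $\mathcal{I}_{pre}(B,\overrightarrow{q})$ such that: (1) no variable of $\overrightarrow{r}$ occurs in it; (2) $\mathcal{I}_{pre}(B,\overrightarrow{q})\Rightarrow B(\overrightarrow{q},\overrightarrow{r})$ is derivable in $\mathsf{G}(\mathbf{KT_n})$; (3) for any formula $A(\overrightarrow{p},\overrightarrow{q})$, where the variables in $\overrightarrow{p}$ are different from those in $\overrightarrow{q}$ and in $\overrightarrow{r}$, if $A(\overrightarrow{p},\overrightarrow{q})\Rightarrow B(\overrightarrow{q},\overrightarrow{r})$ is derivable in $\mathsf{G}(\mathbf{KT_n})$ then so is $A(\overrightarrow{p},\overrightarrow{q})\Rightarrow\mathcal{I}_{pre}(B,\overrightarrow{q})$. (Post-interpolants.) For any formula $A(\overrightarrow{p},\overrightarrow{q})$, where the variables in $\overrightarrow{q}$ are all different from those in $\overrightarrow{p}$, there exists a formula $\mathcal{I}_{post}(A,\overrightarrow{q})$ such that: (1) no variable of $\overrightarrow{p}$ occurs in it; (2) $A(\overrightarrow{p},\overrightarrow{q})\Rightarrow\mathcal{I}_{post}(A,\overrightarrow{q})$ is derivable in $\mathsf{G}(\mathbf{KT_n})$; (3) for any formula $B(\overrightarrow{q},\overrightarrow{r})$, where the variables in $\overrightarrow{r}$ are different from those in $\overrightarrow{q}$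 and in $\overrightarrow{p}$, if $A(\overrightarrow{p},\overrightarrow{q})\Rightarrow B(\overrightarrow{q},\overrightarrow{r})$ is derivable in $\mathsf{G}(\mathbf{KT_n})$ then so is $\mathcal{I}_{post}(A,\overrightarrow{q})\Rightarrow B(\overrightarrow{q},\overrightarrow{r})$.
   Context: Fix a finite set $\mathsf{Agt}$ of agents and a countable set $\mathsf{Prop}$ of propositional variables. Formulas of $\mathcal{L}^1$: $A::=p\mid\bot\mid A\wedge A\mid A\vee A\mid A\rightarrow A\mid\neg A\mid\Box_i A$ ($p\in\mathsf{Prop}$, $i\in\mathsf{Agt}$). An outmost-boxed formula is one of the form $\Box_j B$. $\Box_i\Gamma=\{\Box_iA:A\in\Gamma\}$. $\mathsf{V}(A)$ is the set of propositional variables of $A$; $A(\overrightarrow{q},\overrightarrow{r})$ means $\mathsf{V}(A)\subseteq\{\overrightarrow{q}\}\cup\{\overrightarrow{r}\}$ for finite lists of variables. A sequent $\Gamma\Rightarrow\Delta$ is a pair of finite multisets of formulas. $\mathsf{G}(\mathbf{KT_n})$: initial sequents $\Gamma,p\Rightarrow p,\Delta$ and $\bot,\Gamma\Rightarrow\Delta$; logical rules $(R\wedge)$: $\Gamma\Rightarrow\Delta,A_1$ and $\Gamma\Rightarrow\Delta,A_2$ / $\Gamma\Rightarrow\Delta,A_1\wedge A_2$; $(L\wedge)$: $A_1,A_2,\Gamma\Rightarrow\Delta$ / $A_1\wedge A_2,\Gamma\Rightarrow\Delta$; $(R\vee)$: $\Gamma\Rightarrow\Delta,A_1,A_2$ /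 $\Gamma\Rightarrow\Delta,A_1\vee A_2$; $(L\vee)$: $A_1,\Gamma\Rightarrow\Delta$ and $A_2,\Gamma\Rightarrow\Delta$ / $A_1\vee A_2,\Gamma\Rightarrow\Delta$; $(R\rightarrow)$: $A_1,\Gamma\Rightarrow\Delta,A_2$ / $\Gamma\Rightarrow\Delta,A_1\rightarrow A_2$; $(L\rightarrow)$: $\Gamma\Rightarrow\Delta,A_1$ and $A_2,\Gamma\Rightarrow\Delta$ / $A_1\rightarrow A_2,\Gamma\Rightarrow\Delta$; $(R\neg)$: $A,\Gamma\Rightarrow\Delta$ / $\Gamma\Rightarrow\Delta,\neg A$; $(L\neg)$: $\Gamma\Rightarrow\Delta,A$ / $\neg A,\Gamma\Rightarrow\Delta$. Modal rules: $(\Box_{Kn})$: from $\Gamma\Rightarrow A$ infer $\Sigma,\Box_i\Gamma\Rightarrow\Box_iA,\Omega$, where members of $\Sigma$ are propositional variables, $\bot$, or formulas $\Box_jB$ with $j\neq i$, and members of $\Omega$ are propositional variables, $\bot$, or outmost-boxed formulas; $(\Box_{Tn})$: from $\Box_iA,A,\Gamma\Rightarrow\Delta$ infer $\Box_iA,\Gamma\Rightarrow\Delta$. Derivable means root of a finite tree built from initial sequents by these rules. -}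

module Defs where

open import Data.Nat using (ℕ)
open import Data.Fin using (Fin)
open import Data.List using (List; []; _∷_; _++_; map; [_])
open import Data.List.Membership.Propositional using (_∈_; _∉_)
open import Data.List.Relation.Unary.All using (All)
open import Data.List.Relation.Binary.Permutation.Propositional using (_↭_)
open import Data.Product using (Σ; _×_; ∃)
open import Relation.Binary.PropositionalEquality using (_≡_; _≢_)

data Fm (n : ℕ) : Set where
  var  : ℕ → Fm n
  ⊥'   : Fm n
  _∧'_ : Fm n → Fm n → Fm n
  _∨'_ : Fm n → Fm n → Fm n
  _⇒'_ : Fm n → Fm n → Fm n
  ¬'_  : Fm n → Fm n
  □    : Fin n → Fm n → Fm n

vars : ∀ {n} → Fm n → List ℕ
vars (var p)  = p ∷ []
vars ⊥'       = []
vars (A ∧' B) = vars A ++ vars B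
vars (A ∨' B) = vars A ++ vars B
vars (A ⇒' B) = vars A ++ vars B
vars (¬' A)   = vars A
vars (□ i A)  = vars A

data SigmaOK {n : ℕ} (i : Fin n) : Fm n → Set where
  σ-var : ∀ p → SigmaOK i (var p)
  σ-⊥   : SigmaOK i ⊥'
  σ-□   : ∀ {j} B → j ≢ i → SigmaOK i (□ j B)

data OmegaOK {n : ℕ} : Fm n → Set where
  ω-var : ∀ p → OmegaOK (var p)
  ω-⊥   : OmegaOK ⊥'
  ω-□   : ∀ j B → OmegaOK (□ j B)

-- Sequents are pairs of finite multisets,
-- represented as lists; the multiset reading is implemented by the
-- rule `perm`, which identifies sequents whose sides are permutations
-- of each other (it is not an extra logical rule).
infix 4 _⊢_
data _⊢_ {n : ℕ} : List (Fm n) → List (Fm n) → Set where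
  perm : ∀ {Γ Γ' Δ Δ'} → Γ ↭ Γ' → Δ ↭ Δ' → Γ ⊢ Δ → Γ' ⊢ Δ'
  init : ∀ {Γ Δ} p → var p ∷ Γ ⊢ var p ∷ Δ
  ⊥L   : ∀ {Γ Δ} → ⊥' ∷ Γ ⊢ Δ
  R∧ : ∀ {Γ Δ A₁ A₂} → Γ ⊢ A₁ ∷ Δ → Γ ⊢ A₂ ∷ Δ → Γ ⊢ (A₁ ∧' A₂) ∷ Δ
  L∧ : ∀ {Γ Δ A₁ A₂} → A₁ ∷ A₂ ∷ Γ ⊢ Δ → (A₁ ∧' A₂) ∷ Γ ⊢ Δ
  R∨ : ∀ {Γ Δ A₁ A₂} → Γ ⊢ A₁ ∷ A₂ ∷ Δ → Γ ⊢ (A₁ ∨' A₂) ∷ Δ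
  L∨ : ∀ {Γ Δ A₁ A₂} → A₁ ∷ Γ ⊢ Δ → A₂ ∷ Γ ⊢ Δ → (A₁ ∨' A₂) ∷ Γ ⊢ Δ
  R⇒ : ∀ {Γ Δ A₁ A₂} → A₁ ∷ Γ ⊢ A₂ ∷ Δ → Γ ⊢ (A₁ ⇒' A₂) ∷ Δ
  L⇒ : ∀ {Γ Δ A₁ A₂} → Γ ⊢ A₁ ∷ Δ → A₂ ∷ Γ ⊢ Δ → (A₁ ⇒' A₂) ∷ Γ ⊢ Δ
  R¬ : ∀ {Γ Δ A} → A ∷ Γ ⊢ Δ → Γ ⊢ (¬' A) ∷ Δ
  L¬ : ∀ {Γ Δ A} → Γ ⊢ A ∷ Δ → (¬' A) ∷ Γ ⊢ Δ
  □Kn : ∀ {Γ A Σ' Ω} (i : Fin n) → All (SigmaOK i) Σ' → All OmegaOK Ω →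
        Γ ⊢ [ A ] → Σ' ++ map (□ i) Γ ⊢ □ i A ∷ Ω
  □Tn : ∀ {Γ Δ A} (i : Fin n) → □ i A ∷ A ∷ Γ ⊢ Δ → □ i A ∷ Γ ⊢ Δ

-- V(A) ⊆ xs ∪ ys, i.e. A = A(xs, ys).
_⊆vars_∪_ : ∀ {n} → Fm n → List ℕ → List ℕ → Set
A ⊆vars xs ∪ ys = ∀ x → x ∈ vars A → x ∈ xs ++ ys

Disjoint : List ℕ → List ℕ → Set
Disjoint xs ys = ∀ x → x ∈ xs → x ∉ ys

Avoids : ∀ {n} → Fm n → List ℕ → Set
Avoids A xs = ∀ x → x ∈ vars A → x ∉ xs

-- G(KT_n) is sound and complete for finite tree models in which agent i sees
-- a node and its i-children; completeness comes from a terminating backward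
-- proof search that reads off a countermodel whenever it fails.  The
-- post-interpolant of A over q is then the disjunction of those Hintikka
-- formulas over q, of the modal depth d of A, that are consistent with A.  If
-- t satisfies such a χ and s ⊨ χ ∧ A, then s and t are d-bisimilar over q, and
-- an amalgam of s and t is d-bisimilar to s over the variables of A (so it
-- satisfies A) and fully bisimilar to t over the variables of any B that
-- shares only variables of q with A (so B passes from the amalgam to t).  The
-- pre-interpolant of B is the negated post-interpolant of ¬ B.
module Submission where

open import Defs
open import Data.Nat using (ℕ; zero; suc; _+_; _≤_; _<_; _⊔_; z≤n; s≤s)
open import Data.Nat.Properties
open import Data.Nat.Tactic.RingSolver using (solve-∀)
open import Data.Fin using (Fin)
import Data.Fin as Fin
import Data.Fin.Properties as Fin
open import Data.Bool using (Bool; true; false; T)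
open import Data.Bool.Properties using (T?)
import Data.Bool.Properties as Bool
open import Data.List
  using (List; []; _∷_; _++_; map; [_]; replicate; allFin; filter; cartesianProduct; cartesianProductWith)
open import Data.List.Properties using (++-identityʳ; ++-assoc)
open import Data.List.Membership.Propositional using (_∈_; find; lose)
open import Data.List.Membership.Propositional.Properties
open import Data.List.Membership.DecPropositional Data.Nat._≟_ using (_∈?_)
open import Data.List.Relation.Unary.All as All using (All; []; _∷_)
import Data.List.Relation.Unary.All.Properties as All
open import Data.List.Relation.Unary.Any as Any using (Any; here; there)
open import Data.List.Relation.Binary.Subset.Propositional using (_⊆_)
open import Data.List.Relation.Binary.Subset.Propositional.Properties using (xs⊆xs++ys; xs⊆ys++xs)
open import Data.List.Relation.Binary.Permutation.Propositional
  using (_↭_; prep; swap; ↭-refl; ↭-sym; ↭-trans; ↭-reflexive)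
open import Data.List.Relation.Binary.Permutation.Propositional.Properties using (shift; ++⁺ˡ; All-resp-↭)
open import Data.Product using (∃; _×_; _,_; proj₁; proj₂; uncurry)
import Data.Product as Product
open import Data.Sum using (_⊎_; inj₁; inj₂)
import Data.Sum as Sum
open import Data.Empty using (⊥; ⊥-elim)
open import Function using (_∘_; id)
open import Relation.Nullary using (¬_; Dec; yes; no; contradiction)
open import Relation.Nullary.Decidable
  using (⌊_⌋; toWitness; fromWitness; decidable-stable; ¬?; _×-dec_; _⊎-dec_; _→-dec_)
open import Relation.Binary.PropositionalEquality using (_≡_; refl; sym; trans; cong; subst)

variable
  n : ℕ
  A B : Fm n
  Γ Δ : List (Fm n)
  i : Fin n

T-ext : ∀ {a b} → (T a → T b) → (T b → T a) → a ≡ b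
T-ext {false} {false} _ _ = refl
T-ext {false} {true}  _ g = ⊥-elim (g _)
T-ext {true}  {false} f _ = ⊥-elim (f _)
T-ext {true}  {true}  _ _ = refl

Covers : ∀ {X Y : Set} → (X → Y → Set) → List X → List Y → Set
Covers R xs ys = All (λ x → Any (R x) ys) xs

any-or-all : ∀ {a p q} {X : Set a} {P : X → Set p} {Q : X → Set q} {xs : List X} →
             All (λ x → P x ⊎ Q x) xs → Any P xs ⊎ All Q xs
any-or-all []              = inj₂ []
any-or-all (inj₁ p ∷ _)    = inj₁ (here p)
any-or-all (inj₂ q ∷ rest) = Sum.map there (q ∷_) (any-or-all rest)

↭-front : ∀ {X : Set} {x : X} xs {ys zs} → ys ↭ x ∷ zs → xs ++ ys ↭ x ∷ xs ++ zs
↭-front {x = x} xs {zs = zs} p = ↭-trans (++⁺ˡ xs p) (shift x xs zs)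

∈⇒↭ : ∀ {X : Set} {x : X} {xs} → x ∈ xs → ∃ λ ys → xs ↭ x ∷ ys
∈⇒↭ x∈xs with ys , zs , refl ← ∈-∃++ x∈xs = ys ++ zs , shift _ ys zs

++-⊆⁻ˡ : ∀ (xs : List ℕ) {ys zs} → xs ++ ys ⊆ zs → xs ⊆ zs
++-⊆⁻ˡ xs {ys} p x∈ = p (xs⊆xs++ys xs ys x∈)

++-⊆⁻ʳ : ∀ (xs : List ℕ) {ys zs} → xs ++ ys ⊆ zs → ys ⊆ zs
++-⊆⁻ʳ xs {ys} p y∈ = p (xs⊆ys++xs ys xs y∈)

-- Tree models

-- Agent i reaches from a node the node itself and its i-children, so tree
-- models are reflexive: they are models of KT.
data Tree (n : ℕ) : Set where
  node : (ℕ → Bool) → (Fin n → List (Tree n)) → Tree n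

valuation : Tree n → ℕ → Bool
valuation (node v _) = v

children : Tree n → Fin n → List (Tree n)
children (node _ c) = c

reachable : Tree n → Fin n → List (Tree n)
reachable t i = t ∷ children t i

infix 4 _⊨_ _⊭_ _⊨?_ _⊫_

_⊨_ : Tree n → Fm n → Set
t ⊨ var p  = T (valuation t p)
t ⊨ ⊥'     = ⊥
t ⊨ A ∧' B = t ⊨ A × t ⊨ B
t ⊨ A ∨' B = t ⊨ A ⊎ t ⊨ B
t ⊨ A ⇒' B = t ⊨ A → t ⊨ B
t ⊨ ¬' A   = ¬ t ⊨ A
t ⊨ □ i A  = All (_⊨ A) (reachable t i)

_⊭_ : Tree n → Fm n → Set
t ⊭ A = ¬ t ⊨ A

_⊨?_ : (t : Tree n) (A : Fm n) → Dec (t ⊨ A)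
t ⊨? var p  = T? (valuation t p)
t ⊨? ⊥'     = no id
t ⊨? A ∧' B = t ⊨? A ×-dec t ⊨? B
t ⊨? A ∨' B = t ⊨? A ⊎-dec t ⊨? B
t ⊨? A ⇒' B = t ⊨? A →-dec t ⊨? B
t ⊨? ¬' A   = ¬? (t ⊨? A)
t ⊨? □ i A  = All.all? (_⊨? A) (reachable t i)

_⊫_ : Fm n → Fm n → Set
_⊫_ {n} A B = ∀ (t : Tree n) → t ⊨ A → t ⊨ B

Countermodel : List (Fm n) → List (Fm n) → Set
Countermodel {n} Γ Δ = ∃ λ (t : Tree n) → All (t ⊨_) Γ × All (t ⊭_) Δ

variable
  s t : Tree n

sound : Γ ⊢ Δ → All (t ⊨_) Γ → All (t ⊭_) Δ → ⊥
sound (perm p q d) ⊨Γ ⊭Δ = sound d (All-resp-↭ (↭-sym p) ⊨Γ) (All-resp-↭ (↭-sym q) ⊭Δ)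
sound (init p) (⊨p ∷ _) (⊭p ∷ _) = ⊭p ⊨p
sound ⊥L (() ∷ _) _
sound {t = t} (R∧ {A₁ = A} d e) ⊨Γ (⊭A∧B ∷ ⊭Δ) with t ⊨? A
... | yes ⊨A = sound e ⊨Γ ((λ ⊨B → ⊭A∧B (⊨A , ⊨B)) ∷ ⊭Δ)
... | no ⊭A  = sound d ⊨Γ (⊭A ∷ ⊭Δ)
sound (L∧ d) ((⊨A , ⊨B) ∷ ⊨Γ) ⊭Δ = sound d (⊨A ∷ ⊨B ∷ ⊨Γ) ⊭Δ
sound (R∨ d) ⊨Γ (⊭A∨B ∷ ⊭Δ) = sound d ⊨Γ (⊭A∨B ∘ inj₁ ∷ ⊭A∨B ∘ inj₂ ∷ ⊭Δ)
sound (L∨ d e) (inj₁ ⊨A ∷ ⊨Γ) ⊭Δ = sound d (⊨A ∷ ⊨Γ) ⊭Δ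
sound (L∨ d e) (inj₂ ⊨B ∷ ⊨Γ) ⊭Δ = sound e (⊨B ∷ ⊨Γ) ⊭Δ
sound {t = t} (R⇒ {A₁ = A} d) ⊨Γ (⊭A⇒B ∷ ⊭Δ) =
  sound d (decidable-stable (t ⊨? A) (λ ⊭A → ⊭A⇒B (⊥-elim ∘ ⊭A)) ∷ ⊨Γ)
          ((λ ⊨B → ⊭A⇒B (λ _ → ⊨B)) ∷ ⊭Δ)
sound {t = t} (L⇒ {A₁ = A} d e) (⊨A⇒B ∷ ⊨Γ) ⊭Δ with t ⊨? A
... | yes ⊨A = sound e (⊨A⇒B ⊨A ∷ ⊨Γ) ⊭Δ
... | no ⊭A  = sound d ⊨Γ (⊭A ∷ ⊭Δ)
sound {t = t} (R¬ {A = A} d) ⊨Γ (⊭¬A ∷ ⊭Δ) = sound d (decidable-stable (t ⊨? A) ⊭¬A ∷ ⊨Γ) ⊭Δ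
sound (L¬ d) (⊭A ∷ ⊨Γ) ⊭Δ = sound d ⊨Γ (⊭A ∷ ⊭Δ)
sound (□Kn {A = A} {Σ' = Σ'} i _ _ d) ⊨Γ (⊭□A ∷ _) =
  let _ , c∈ , c⊭A = find (All.¬All⇒Any¬ (_⊨? A) _ ⊭□A)
  in sound d (All.map (λ ⊨□C → All.lookup ⊨□C c∈) (All.map⁻ (All.++⁻ʳ Σ' ⊨Γ))) (c⊭A ∷ [])
sound (□Tn i d) (⊨□A ∷ ⊨Γ) ⊭Δ = sound d (⊨□A ∷ All.head ⊨□A ∷ ⊨Γ) ⊭Δ

sound-⊫ : [ A ] ⊢ [ B ] → A ⊫ B
sound-⊫ {B = B} d t ⊨A = decidable-stable (t ⊨? B) λ ⊭B → sound d (⊨A ∷ []) (⊭B ∷ [])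

-- Proof search

data Signed (n : ℕ) : Set where
  left right : Fm n → Signed n

antecedent : List (Signed n) → List (Fm n)
antecedent []            = []
antecedent (left A ∷ S)  = A ∷ antecedent S
antecedent (right _ ∷ S) = antecedent S

succedent : List (Signed n) → List (Fm n)
succedent []            = []
succedent (left _ ∷ S)  = succedent S
succedent (right A ∷ S) = A ∷ succedent S

Refutes : Tree n → Signed n → Set
Refutes t (left A)  = t ⊨ A
Refutes t (right A) = t ⊭ A

signed : List (Fm n) → List (Fm n) → List (Signed n)
signed Γ Δ = map right Δ ++ map left Γ

antecedent-lefts : (Γ : List (Fm n)) → antecedent (map left Γ) ≡ Γ
antecedent-lefts []      = refl
antecedent-lefts (A ∷ Γ) = cong (A ∷_) (antecedent-lefts Γ)

succedent-lefts : (Γ : List (Fm n)) → succedent (map left Γ) ≡ []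
succedent-lefts []      = refl
succedent-lefts (A ∷ Γ) = succedent-lefts Γ

antecedent-signed : (Γ Δ : List (Fm n)) → antecedent (signed Γ Δ) ≡ Γ
antecedent-signed Γ []      = antecedent-lefts Γ
antecedent-signed Γ (_ ∷ Δ) = antecedent-signed Γ Δ

succedent-signed : (Γ Δ : List (Fm n)) → succedent (signed Γ Δ) ≡ Δ
succedent-signed Γ []      = succedent-lefts Γ
succedent-signed Γ (B ∷ Δ) = cong (B ∷_) (succedent-signed Γ Δ)

boxed : Fin n × Fm n → Fm n
boxed (i , A) = □ i A

-- The part of a sequent that search has finished decomposing.  Falsum on the
-- right is only counted: it is false anyway, but it must be carried along
-- because (□Kn) cannot weaken it in.
record Processed (n : ℕ) : Set where
  constructor processed
  field
    atomsˡ : List ℕ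
    boxesˡ : List (Fin n × Fm n)
    falsaʳ : ℕ
    atomsʳ : List ℕ
    boxesʳ : List (Fin n × Fm n)

open Processed

nothing-processed : Processed n
nothing-processed = processed [] [] 0 [] []

antecedentᵖ : Processed n → List (Fm n)
antecedentᵖ π = map var (atomsˡ π) ++ map boxed (boxesˡ π)

succedentᵖ : Processed n → List (Fm n)
succedentᵖ π = replicate (falsaʳ π) ⊥' ++ map var (atomsʳ π) ++ map boxed (boxesʳ π)

-- A left box □ i A has already been unfolded once by (□Tn), so at the root
-- it only constrains the i-children.
Refutesᵖ : Tree n → Processed n → Set
Refutesᵖ t π =
  All ((t ⊨_) ∘ var) (atomsˡ π) × All (λ (i , A) → All (_⊨ A) (children t i)) (boxesˡ π) ×
  All ((t ⊭_) ∘ var) (atomsʳ π) × All ((t ⊭_) ∘ boxed) (boxesʳ π)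

Closed : List (Signed n) → Processed n → Set
Closed S π = antecedent S ++ antecedentᵖ π ⊢ succedent S ++ succedentᵖ π

Countermodelˢ : List (Signed n) → Processed n → Set
Countermodelˢ {n} S π = ∃ λ (t : Tree n) → All (Refutes t) S × Refutesᵖ t π

data Result (S : List (Signed n)) (π : Processed n) : Set where
  closed  : Closed S π → Result S π
  refuted : Countermodelˢ S π → Result S π

-- Boxes weigh double: a left box hands its body both to the pending formulas
-- and to the processed boxes.
size : Fm n → ℕ
size (var _)  = 1
size ⊥'       = 1
size (A ∧' B) = suc (size A + size B)
size (A ∨' B) = suc (size A + size B)
size (A ⇒' B) = suc (size A + size B)
size (¬' A)   = suc (size A)
size (□ i A)  = suc (suc (size A + size A))

∣_∣ : Signed n → ℕ
∣ left A ∣  = size A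
∣ right A ∣ = size A

weight : List (Signed n) → ℕ
weight []      = 0
weight (X ∷ S) = ∣ X ∣ + weight S

weightˡ : List (Fin n × Fm n) → ℕ
weightˡ []            = 0
weightˡ ((_ , A) ∷ U) = size A + weightˡ U

weightʳ : List (Fin n × Fm n) → ℕ
weightʳ []            = 0
weightʳ ((_ , B) ∷ W) = suc (size B) + weightʳ W

weightᵖ : Processed n → ℕ
weightᵖ π = weightˡ (boxesˡ π) + weightʳ (boxesʳ π)

μ : List (Signed n) → Processed n → ℕ
μ S π = weight S + weightᵖ π

variable
  S : List (Signed n)
  π π′ : Processed n
  X Y Z : Signed n

-- A record, so that both sequents can be inferred from a goal (μ is not
-- injective).
record _≺_ (σ τ : List (Signed n) × Processed n) : Set where
  constructor by-μ
  field
    μ-< : uncurry μ σ < uncurry μ τ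

open _≺_

≺-pending₁ : ∣ X ∣ < ∣ Y ∣ → (X ∷ S , π) ≺ (Y ∷ S , π)
≺-pending₁ p = by-μ (+-monoˡ-< _ (+-monoˡ-< _ p))

≺-pending₂ : ∣ X ∣ + ∣ Y ∣ < ∣ Z ∣ → (X ∷ Y ∷ S , π) ≺ (Z ∷ S , π)
≺-pending₂ {X = X} {Y} {Z} {S} {π} p = by-μ (+-monoˡ-< (weightᵖ π)
  (subst (_< ∣ Z ∣ + weight S) (+-assoc ∣ X ∣ ∣ Y ∣ (weight S)) (+-monoˡ-< (weight S) p)))

≺-atom : weightᵖ π′ ≡ weightᵖ π → ∣ X ∣ ≡ 1 → (S , π′) ≺ (X ∷ S , π)
≺-atom {π′ = π′} {π = π} {X = X} {S = S} w≡ ∣X∣≡1 = by-μ (begin-strict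
  weight S + weightᵖ π′        ≡⟨ cong (weight S +_) w≡ ⟩
  weight S + weightᵖ π         <⟨ n<1+n _ ⟩
  1 + weight S + weightᵖ π     ≡⟨ cong (λ k → k + weight S + weightᵖ π) (sym ∣X∣≡1) ⟩
  ∣ X ∣ + weight S + weightᵖ π ∎)
  where open ≤-Reasoning

≺-boxˡ : (left A ∷ S , record π { boxesˡ = (i , A) ∷ boxesˡ π }) ≺ (left (□ i A) ∷ S , π)
≺-boxˡ {A = A} {S = S} {π = π} =
  by-μ (s≤s (m≤n⇒m≤1+n (≤-reflexive (shuffle (size A) (weight S) (weightˡ (boxesˡ π)) (weightʳ (boxesʳ π))))))
  where
  shuffle : ∀ a w u v → a + w + (a + u + v) ≡ a + a + w + (u + v)
  shuffle = solve-∀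

≺-boxʳ : (S , record π { boxesʳ = (i , B) ∷ boxesʳ π }) ≺ (right (□ i B) ∷ S , π)
≺-boxʳ {S = S} {π = π} {i = i} {B = B} =
  by-μ (subst (suc (μ S (record π { boxesʳ = (i , B) ∷ boxesʳ π })) ≤_)
    (shuffle (size B) (weight S) (weightˡ (boxesˡ π)) (weightʳ (boxesʳ π))) (m≤m+n _ (size B)))
  where
  shuffle : ∀ b w u v → suc (w + (u + (suc b + v))) + b ≡ suc (suc (b + b)) + w + (u + v)
  shuffle = solve-∀

bodies : Fin n → List (Fin n × Fm n) → List (Fm n)
bodies i [] = []
bodies i ((j , A) ∷ U) with j Fin.≟ i
... | yes _ = A ∷ bodies i U
... | no _  = bodies i U

others : Fin n → List (Fin n × Fm n) → List (Fm n)
others i [] = []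
others i ((j , A) ∷ U) with j Fin.≟ i
... | yes _ = others i U
... | no _  = □ j A ∷ others i U

boxed-↭ : ∀ i (U : List (Fin n × Fm n)) → map boxed U ↭ others i U ++ map (□ i) (bodies i U)
boxed-↭ i [] = ↭-refl
boxed-↭ i ((j , A) ∷ U) with j Fin.≟ i
... | yes refl = ↭-trans (prep (□ i A) (boxed-↭ i U)) (↭-sym (shift (□ i A) (others i U) _))
... | no _     = prep (□ j A) (boxed-↭ i U)

others-Σ : ∀ i (U : List (Fin n × Fm n)) → All (SigmaOK i) (others i U)
others-Σ i [] = []
others-Σ i ((j , A) ∷ U) with j Fin.≟ i
... | yes _  = others-Σ i U
... | no j≢i = σ-□ A j≢i ∷ others-Σ i U

∈-bodies : ∀ {U : List (Fin n × Fm n)} → (i , A) ∈ U → A ∈ bodies i U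
∈-bodies {i = i} {U = (j , _) ∷ _} A∈ with j Fin.≟ i | A∈
... | yes _  | here refl = here refl
... | yes _  | there A∈′ = there (∈-bodies A∈′)
... | no j≢i | here refl = contradiction refl j≢i
... | no _   | there A∈′ = ∈-bodies A∈′

weight-bodies : ∀ i (U : List (Fin n × Fm n)) → weight (map left (bodies i U)) ≤ weightˡ U
weight-bodies i [] = z≤n
weight-bodies i ((j , A) ∷ U) with j Fin.≟ i
... | yes _ = +-monoʳ-≤ (size A) (weight-bodies i U)
... | no _  = ≤-trans (weight-bodies i U) (m≤n+m _ (size A))

size<weightʳ : ∀ {W : List (Fin n × Fm n)} → (i , B) ∈ W → size B < weightʳ W
size<weightʳ (here refl) = m≤m+n _ _
size<weightʳ {W = (_ , C) ∷ _} (there B∈) = ≤-trans (size<weightʳ B∈) (m≤n+m _ (suc (size C)))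

≺-modal-premise : (i , B) ∈ boxesʳ π →
                  (signed (bodies i (boxesˡ π)) [ B ] , nothing-processed) ≺ ([] , π)
≺-modal-premise {i = i} {B = B} {π = π} B∈ = by-μ (begin-strict
  size B + weight (map left (bodies i U)) + 0 ≡⟨ +-identityʳ _ ⟩
  size B + weight (map left (bodies i U))     <⟨ +-mono-<-≤ (size<weightʳ B∈) (weight-bodies i U) ⟩
  weightʳ (boxesʳ π) + weightˡ U              ≡⟨ +-comm _ (weightˡ U) ⟩
  weightˡ U + weightʳ (boxesʳ π)              ∎)
  where
  U : List (Fin _ × Fm _)
  U = boxesˡ π
  open ≤-Reasoning

rule₁ : ∀ {S′ : List (Signed n)} → (Closed S′ π → Closed S π) →
        (∀ {t} → All (Refutes t) S′ → All (Refutes t) S) → Result S′ π → Result S π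
rule₁ close back (closed d)  = closed (close d)
rule₁ close back (refuted m) = refuted (Product.map₂ (Product.map₁ back) m)

rule₂ : ∀ {S₁ S₂ : List (Signed n)} → (Closed S₁ π → Closed S₂ π → Closed S π) →
        (∀ {t} → All (Refutes t) S₁ → All (Refutes t) S) →
        (∀ {t} → All (Refutes t) S₂ → All (Refutes t) S) →
        Result S₁ π → Result S₂ π → Result S π
rule₂ close back₁ back₂ (closed d₁) (closed d₂) = closed (close d₁ d₂)
rule₂ close back₁ back₂ (refuted m) _           = refuted (Product.map₂ (Product.map₁ back₁) m)
rule₂ close back₁ back₂ (closed _)  (refuted m) = refuted (Product.map₂ (Product.map₁ back₂) m)

Below : List (Signed n) → Processed n → Set
Below {n} S π = ∀ (S′ : List (Signed n)) π′ → (S′ , π′) ≺ (S , π) → Result S′ π′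

expandˡ : ∀ (A : Fm n) S π → Below (left A ∷ S) π → Result (left A ∷ S) π
expandˡ (var p) S π rec with rec S (record π { atomsˡ = p ∷ atomsˡ π }) (≺-atom refl refl)
... | closed d = closed (perm (shift (var p) (antecedent S) _) ↭-refl d)
... | refuted (t , h , ⊨p ∷ ⊨ps , r) = refuted (t , ⊨p ∷ h , ⊨ps , r)
expandˡ ⊥' S π rec = closed ⊥L
expandˡ (A ∧' B) S π rec =
  rule₁ L∧ (λ { (⊨A ∷ ⊨B ∷ h) → (⊨A , ⊨B) ∷ h })
    (rec (left A ∷ left B ∷ S) π (≺-pending₂ (n<1+n _)))
expandˡ (A ∨' B) S π rec =
  rule₂ L∨ (λ { (⊨A ∷ h) → inj₁ ⊨A ∷ h }) (λ { (⊨B ∷ h) → inj₂ ⊨B ∷ h })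
    (rec (left A ∷ S) π (≺-pending₁ (s≤s (m≤m+n _ _))))
    (rec (left B ∷ S) π (≺-pending₁ (s≤s (m≤n+m _ _))))
expandˡ (A ⇒' B) S π rec =
  rule₂ L⇒ (λ { (⊭A ∷ h) → (⊥-elim ∘ ⊭A) ∷ h }) (λ { (⊨B ∷ h) → (λ _ → ⊨B) ∷ h })
    (rec (right A ∷ S) π (≺-pending₁ (s≤s (m≤m+n _ _))))
    (rec (left B ∷ S) π (≺-pending₁ (s≤s (m≤n+m _ _))))
expandˡ (¬' A) S π rec =
  rule₁ L¬ (λ { (⊭A ∷ h) → ⊭A ∷ h }) (rec (right A ∷ S) π (≺-pending₁ (n<1+n _)))
expandˡ (□ i A) S π rec with rec (left A ∷ S) (record π { boxesˡ = (i , A) ∷ boxesˡ π }) ≺-boxˡ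
... | closed d = closed (□Tn i (perm
  (↭-trans (prep A (↭-front (antecedent S) (↭-front (map var (atomsˡ π)) ↭-refl))) (swap A (□ i A) ↭-refl))
  ↭-refl d))
... | refuted (t , ⊨A ∷ h , ⊨ps , ⊨A-below ∷ ⊨Us , r) =
  refuted (t , (⊨A ∷ ⊨A-below) ∷ h , ⊨ps , ⊨Us , r)

expandʳ : ∀ (A : Fm n) S π → Below (right A ∷ S) π → Result (right A ∷ S) π
expandʳ (var p) S π rec with rec S (record π { atomsʳ = p ∷ atomsʳ π }) (≺-atom refl refl)
... | closed d =
  closed (perm ↭-refl (↭-front (succedent S) (↭-front (replicate (falsaʳ π) ⊥') ↭-refl)) d)
... | refuted (t , h , ⊨ps , ⊨Us , ⊭p ∷ ⊭qs , r) = refuted (t , ⊭p ∷ h , ⊨ps , ⊨Us , ⊭qs , r)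
expandʳ ⊥' S π rec with rec S (record π { falsaʳ = suc (falsaʳ π) }) (≺-atom refl refl)
... | closed d = closed (perm ↭-refl (shift ⊥' (succedent S) _) d)
... | refuted (t , h , r) = refuted (t , id ∷ h , r)
expandʳ (A ∧' B) S π rec =
  rule₂ R∧ (λ { (⊭A ∷ h) → (⊭A ∘ proj₁) ∷ h }) (λ { (⊭B ∷ h) → (⊭B ∘ proj₂) ∷ h })
    (rec (right A ∷ S) π (≺-pending₁ (s≤s (m≤m+n _ _))))
    (rec (right B ∷ S) π (≺-pending₁ (s≤s (m≤n+m _ _))))
expandʳ (A ∨' B) S π rec =
  rule₁ R∨ (λ { (⊭A ∷ ⊭B ∷ h) → Sum.[ ⊭A , ⊭B ] ∷ h })
    (rec (right A ∷ right B ∷ S) π (≺-pending₂ (n<1+n _)))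
expandʳ (A ⇒' B) S π rec =
  rule₁ R⇒ (λ { (⊨A ∷ ⊭B ∷ h) → (λ ⊨A⇒B → ⊭B (⊨A⇒B ⊨A)) ∷ h })
    (rec (left A ∷ right B ∷ S) π (≺-pending₂ (n<1+n _)))
expandʳ (¬' A) S π rec =
  rule₁ R¬ (λ { (⊨A ∷ h) → (λ ⊭A → ⊭A ⊨A) ∷ h }) (rec (left A ∷ S) π (≺-pending₁ (n<1+n _)))
expandʳ (□ i B) S π rec with rec S (record π { boxesʳ = (i , B) ∷ boxesʳ π }) ≺-boxʳ
... | closed d = closed (perm ↭-refl
  (↭-front (succedent S) (↭-front (replicate (falsaʳ π) ⊥') (↭-front (map var (atomsʳ π)) ↭-refl))) d)
... | refuted (t , h , ⊨ps , ⊨Us , ⊭qs , ⊭□B ∷ ⊭Ws) = refuted (t , ⊭□B ∷ h , ⊨ps , ⊨Us , ⊭qs , ⊭Ws)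

Provable Refutable : List (Fin n × Fm n) → Fin n × Fm n → Set
Provable U (i , B)  = bodies i U ⊢ [ B ]
Refutable U (i , B) = Countermodel (bodies i U) [ B ]

witnesses : ∀ (U : List (Fin n × Fm n)) {W} → All (Refutable U) W → Fin n → List (Tree n)
witnesses U [] i = []
witnesses U {(j , _) ∷ _} (m ∷ ms) i with j Fin.≟ i
... | yes _ = proj₁ m ∷ witnesses U ms i
... | no _  = witnesses U ms i

module _ (U : List (Fin n × Fm n)) where

  witnesses-bodies : ∀ {W c} (ms : All (Refutable U) W) → c ∈ witnesses U ms i → All (c ⊨_) (bodies i U)
  witnesses-bodies {i = i} {W = (j , _) ∷ _} (m ∷ ms) c∈ with j Fin.≟ i
  witnesses-bodies (m ∷ ms) (here refl) | yes refl = proj₁ (proj₂ m)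
  witnesses-bodies (m ∷ ms) (there c∈)  | yes _    = witnesses-bodies ms c∈
  witnesses-bodies (m ∷ ms) c∈          | no _     = witnesses-bodies ms c∈

  witnesses-refute : ∀ {W} (ms : All (Refutable U) W) → (i , B) ∈ W → Any (_⊭ B) (witnesses U ms i)
  witnesses-refute {i = i} {W = (j , _) ∷ _} (m ∷ ms) B∈ with j Fin.≟ i
  witnesses-refute (m ∷ ms) (here refl) | yes _  = here (All.head (proj₂ (proj₂ m)))
  witnesses-refute (m ∷ ms) (there B∈)  | yes _  = there (witnesses-refute ms B∈)
  witnesses-refute (m ∷ ms) (here refl) | no j≢i = contradiction refl j≢i
  witnesses-refute (m ∷ ms) (there B∈)  | no _   = witnesses-refute ms B∈

close-by-init : ∀ (π : Processed n) → Any (_∈ atomsˡ π) (atomsʳ π) → Closed [] π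
close-by-init π shared =
  let p , p∈ʳ , p∈ˡ = find shared
      _ , lhs = ∈⇒↭ (∈-++⁺ˡ {ys = map boxed (boxesˡ π)} (∈-map⁺ var p∈ˡ))
      _ , rhs = ∈⇒↭ (∈-++⁺ʳ (replicate (falsaʳ π) ⊥')
                       (∈-++⁺ˡ {ys = map boxed (boxesʳ π)} (∈-map⁺ var p∈ʳ)))
  in perm (↭-sym lhs) (↭-sym rhs) (init p)

succedentᵖ-Ω : (π : Processed n) → All OmegaOK (succedentᵖ π)
succedentᵖ-Ω π = All.++⁺ (All.replicate⁺ (falsaʳ π) ω-⊥)
  (All.++⁺ (All.map⁺ (All.universal ω-var (atomsʳ π))) (All.map⁺ (All.universal (uncurry ω-□) (boxesʳ π))))

close-by-Kn : ∀ (π : Processed n) → Any (Provable (boxesˡ π)) (boxesʳ π) → Closed [] π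
close-by-Kn π provable =
  let (i , B) , B∈ , d = find provable
      _ , rhs = ∈⇒↭ (∈-++⁺ʳ (replicate (falsaʳ π) ⊥')
                       (∈-++⁺ʳ (map var (atomsʳ π)) (∈-map⁺ boxed B∈)))
      lhs = ↭-trans (↭-reflexive (++-assoc (map var (atomsˡ π)) _ _))
                    (++⁺ˡ (map var (atomsˡ π)) (↭-sym (boxed-↭ i (boxesˡ π))))
      Σ-ok = All.++⁺ (All.map⁺ (All.universal σ-var _)) (others-Σ i (boxesˡ π))
      Ω-ok = All.tail (All-resp-↭ rhs (succedentᵖ-Ω π))
  in perm lhs (↭-sym rhs) (□Kn i Σ-ok Ω-ok d)

countermodel : ∀ (π : Processed n) → ¬ Any (_∈ atomsˡ π) (atomsʳ π) →
               All (Refutable (boxesˡ π)) (boxesʳ π) → Countermodelˢ [] π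
countermodel {n} π disjoint ms = root , [] , atomsˡ-true , boxesˡ-below , atomsʳ-false , boxesʳ-false
  where
  root : Tree n
  root = node (λ p → ⌊ p ∈? atomsˡ π ⌋) (witnesses (boxesˡ π) ms)
  atomsˡ-true : All ((root ⊨_) ∘ var) (atomsˡ π)
  atomsˡ-true = All.tabulate fromWitness
  boxesˡ-below : All (λ (i , A) → All (_⊨ A) (children root i)) (boxesˡ π)
  boxesˡ-below = All.tabulate λ A∈ → All.tabulate λ c∈ →
    All.lookup (witnesses-bodies (boxesˡ π) ms c∈) (∈-bodies A∈)
  atomsʳ-false : All ((root ⊭_) ∘ var) (atomsʳ π)
  atomsʳ-false = All.tabulate λ p∈ʳ p∈ˡ → disjoint (lose p∈ʳ (toWitness p∈ˡ))
  boxesʳ-false : All ((root ⊭_) ∘ boxed) (boxesʳ π)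
  boxesʳ-false = All.tabulate λ B∈ ⊨□B →
    let _ , c∈ , c⊭B = find (witnesses-refute (boxesˡ π) ms B∈) in c⊭B (All.lookup (All.tail ⊨□B) c∈)

saturated : ∀ (π : Processed n) →
            (∀ {x} → x ∈ boxesʳ π → Provable (boxesˡ π) x ⊎ Refutable (boxesˡ π) x) → Result [] π
saturated π premise with Any.any? (_∈? atomsˡ π) (atomsʳ π)
... | yes shared = closed (close-by-init π shared)
... | no disjoint with any-or-all (All.tabulate premise)
...   | inj₁ provable  = closed (close-by-Kn π provable)
...   | inj₂ refutable = refuted (countermodel π disjoint refutable)

from-signed : Result (signed Γ Δ) nothing-processed → Γ ⊢ Δ ⊎ Countermodel Γ Δ
from-signed {Γ = Γ} {Δ = Δ} (closed d) =
  inj₁ (perm (↭-reflexive (trans (++-identityʳ _) (antecedent-signed Γ Δ)))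
             (↭-reflexive (trans (++-identityʳ _) (succedent-signed Γ Δ))) d)
from-signed {Δ = Δ} (refuted (t , h , _)) =
  let ⊭Δ , ⊨Γ = All.++⁻ (map right Δ) h in inj₂ (t , All.map⁻ ⊨Γ , All.map⁻ ⊭Δ)

search : ∀ f (S : List (Signed n)) π → μ S π < f → Result S π
search zero    S π ()
search (suc f) S π μ<f =
  step S π λ S′ π′ S′≺S → search f S′ π′ (<-≤-trans (μ-< S′≺S) (≤-pred μ<f))
  where
  step : ∀ S π → Below S π → Result S π
  step []            π rec = saturated π λ { {i , B} B∈ → from-signed (rec _ _ (≺-modal-premise B∈)) }
  step (left A ∷ S)  π rec = expandˡ A S π rec
  step (right A ∷ S) π rec = expandʳ A S π rec

decide : (Γ Δ : List (Fm n)) → Γ ⊢ Δ ⊎ Countermodel Γ Δ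
decide Γ Δ = from-signed (search _ (signed Γ Δ) nothing-processed (n<1+n _))

complete : A ⊫ B → [ A ] ⊢ [ B ]
complete {A = A} {B = B} A⊫B with decide [ A ] [ B ]
... | inj₁ d = d
... | inj₂ (t , ⊨A ∷ [] , ⊭B ∷ []) = ⊥-elim (⊭B (A⊫B t ⊨A))

satisfiable? : (A : Fm n) → Dec (∃ λ t → t ⊨ A)
satisfiable? A with decide [ A ] []
... | inj₁ d = no λ (t , ⊨A) → sound d (⊨A ∷ []) []
... | inj₂ (t , ⊨A ∷ [] , []) = yes (t , ⊨A)

-- Bounded bisimulation

Agree : List ℕ → Tree n → Tree n → Set
Agree V s t = All (λ v → valuation s v ≡ valuation t v) V

Bisim : List ℕ → ℕ → Tree n → Tree n → Set
Bisim V zero    s t = Agree V s t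
Bisim V (suc k) s t = Agree V s t × (∀ i →
  Covers (Bisim V k) (reachable s i) (reachable t i) ×
  Covers (λ y x → Bisim V k x y) (reachable t i) (reachable s i))

variable
  V : List ℕ
  k : ℕ

bisim-agree : ∀ k → Bisim V k s t → Agree V s t
bisim-agree zero    s≈t      = s≈t
bisim-agree (suc k) (ag , _) = ag

bisim-refl : ∀ k (t : Tree n) → Bisim V k t t
bisim-refl zero    t = All.universal (λ _ → refl) _
bisim-refl (suc k) t = All.universal (λ _ → refl) _ , λ i →
  All.tabulate (λ x∈ → lose x∈ (bisim-refl k _)) , All.tabulate (λ y∈ → lose y∈ (bisim-refl k _))

bisim-sym : ∀ k → Bisim V k s t → Bisim V k t s
bisim-sym zero    ag        = All.map sym ag
bisim-sym (suc k) (ag , zz) = All.map sym ag , λ i →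
  All.map (Any.map (bisim-sym k)) (proj₂ (zz i)) , All.map (Any.map (bisim-sym k)) (proj₁ (zz i))

bisim? : ∀ V k (s t : Tree n) → Dec (Bisim V k s t)
bisim? V zero    s t = All.all? (λ v → valuation s v Bool.≟ valuation t v) V
bisim? V (suc k) s t = bisim? V zero s t ×-dec Fin.all? λ i →
  All.all? (λ x → Any.any? (bisim? V k x) _) _ ×-dec All.all? (λ y → Any.any? (λ x → bisim? V k x y) _) _

depth : Fm n → ℕ
depth (var _)  = 0
depth ⊥'       = 0
depth (A ∧' B) = depth A ⊔ depth B
depth (A ∨' B) = depth A ⊔ depth B
depth (A ⇒' B) = depth A ⊔ depth B
depth (¬' A)   = depth A
depth (□ i A)  = suc (depth A)

⊨-bisim : ∀ (A : Fm n) → depth A ≤ k → vars A ⊆ V → Bisim V k s t → s ⊨ A → t ⊨ A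
⊨-bisim {k = k} (var p) _ V⊆ s≈t = subst T (All.lookup (bisim-agree k s≈t) (V⊆ (here refl)))
⊨-bisim ⊥' _ _ _ ()
⊨-bisim (A ∧' B) d V⊆ s≈t = Product.map
  (⊨-bisim A (m⊔n≤o⇒m≤o _ _ d) (++-⊆⁻ˡ (vars A) V⊆) s≈t)
  (⊨-bisim B (m⊔n≤o⇒n≤o _ _ d) (++-⊆⁻ʳ (vars A) V⊆) s≈t)
⊨-bisim (A ∨' B) d V⊆ s≈t = Sum.map
  (⊨-bisim A (m⊔n≤o⇒m≤o _ _ d) (++-⊆⁻ˡ (vars A) V⊆) s≈t)
  (⊨-bisim B (m⊔n≤o⇒n≤o _ _ d) (++-⊆⁻ʳ (vars A) V⊆) s≈t)
⊨-bisim {k = k} (A ⇒' B) d V⊆ s≈t s⊨A⇒B =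
  ⊨-bisim B (m⊔n≤o⇒n≤o _ _ d) (++-⊆⁻ʳ (vars A) V⊆) s≈t ∘ s⊨A⇒B ∘
  ⊨-bisim A (m⊔n≤o⇒m≤o _ _ d) (++-⊆⁻ˡ (vars A) V⊆) (bisim-sym k s≈t)
⊨-bisim {k = k} (¬' A) d V⊆ s≈t s⊭A = s⊭A ∘ ⊨-bisim A d V⊆ (bisim-sym k s≈t)
⊨-bisim {k = suc k} (□ i A) (s≤s d) V⊆ (_ , zz) s⊨□A = All.tabulate λ y∈ →
  let _ , x∈ , x≈y = find (All.lookup (proj₂ (zz i)) y∈) in ⊨-bisim A d V⊆ x≈y (All.lookup s⊨□A x∈)

-- Hintikka formulas

⊤' : Fm n
⊤' = ¬' ⊥'

◇ : Fin n → Fm n → Fm n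
◇ i A = ¬' □ i (¬' A)

⊨◇⁺ : Any (_⊨ A) (reachable t i) → t ⊨ ◇ i A
⊨◇⁺ some none = All.All¬⇒¬Any none some

⊨◇⁻ : ∀ {A : Fm n} → t ⊨ ◇ i A → Any (_⊨ A) (reachable t i)
⊨◇⁻ {A = A} ⊨◇A = Any.map (decidable-stable (_ ⊨? A)) (All.¬All⇒Any¬ (λ c → ¬? (c ⊨? A)) _ ⊨◇A)

minterms : List (Fm n) → List (Fm n)
minterms []      = [ ⊤' ]
minterms (φ ∷ L) = map (φ ∧'_) (minterms L) ++ map ((¬' φ) ∧'_) (minterms L)

minterms-cover : ∀ (L : List (Fm n)) t → ∃ λ χ → χ ∈ minterms L × t ⊨ χ
minterms-cover []      t = ⊤' , here refl , id
minterms-cover (φ ∷ L) t with minterms-cover L t | t ⊨? φ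
... | χ , χ∈ , t⊨χ | yes t⊨φ = φ ∧' χ , ∈-++⁺ˡ (∈-map⁺ (φ ∧'_) χ∈) , t⊨φ , t⊨χ
... | χ , χ∈ , t⊨χ | no t⊭φ  = (¬' φ) ∧' χ , ∈-++⁺ʳ _ (∈-map⁺ ((¬' φ) ∧'_) χ∈) , t⊭φ , t⊨χ

minterms-agree : ∀ (L : List (Fm n)) {χ} → χ ∈ minterms L → s ⊨ χ → t ⊨ χ →
                 All (λ φ → s ⊨ φ → t ⊨ φ) L
minterms-agree []      _  _   _   = []
minterms-agree (φ ∷ L) χ∈ s⊨χ t⊨χ with ∈-++⁻ (map (φ ∧'_) (minterms L)) χ∈
... | inj₁ χ∈⁺ with _ , χ′∈ , refl ← ∈-map⁻ (φ ∧'_) χ∈⁺ =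
  (λ _ → proj₁ t⊨χ) ∷ minterms-agree L χ′∈ (proj₂ s⊨χ) (proj₂ t⊨χ)
... | inj₂ χ∈⁻ with _ , χ′∈ , refl ← ∈-map⁻ ((¬' φ) ∧'_) χ∈⁻ =
  (⊥-elim ∘ proj₁ s⊨χ) ∷ minterms-agree L χ′∈ (proj₂ s⊨χ) (proj₂ t⊨χ)

minterms-vars : ∀ (L : List (Fm n)) {χ} → (∀ {φ} → φ ∈ L → vars φ ⊆ V) → χ ∈ minterms L → vars χ ⊆ V
minterms-vars [] _ (here refl) ()
minterms-vars (φ ∷ L) L⊆ χ∈ v∈ with ∈-++⁻ (map (φ ∧'_) (minterms L)) χ∈
... | inj₁ χ∈⁺ with _ , χ′∈ , refl ← ∈-map⁻ (φ ∧'_) χ∈⁺ =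
  Sum.[ L⊆ (here refl) , minterms-vars L (L⊆ ∘ there) χ′∈ ] (∈-++⁻ (vars φ) v∈)
... | inj₂ χ∈⁻ with _ , χ′∈ , refl ← ∈-map⁻ ((¬' φ) ∧'_) χ∈⁻ =
  Sum.[ L⊆ (here refl) , minterms-vars L (L⊆ ∘ there) χ′∈ ] (∈-++⁻ (vars φ) v∈)

module _ (q : List ℕ) where

  hintikka : ℕ → List (Fm n)
  diamonds : ℕ → List (Fm n)

  hintikka k = minterms (map var q ++ diamonds k)

  diamonds zero    = []
  diamonds (suc k) = cartesianProductWith ◇ (allFin _) (hintikka k)

  hintikka-cover : ∀ k (t : Tree n) → ∃ λ χ → χ ∈ hintikka k × t ⊨ χ
  hintikka-cover k = minterms-cover (map var q ++ diamonds k)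

  hintikka-vars : ∀ k {χ : Fm n} → χ ∈ hintikka k → vars χ ⊆ q
  literals-vars : ∀ k {φ : Fm n} → φ ∈ map var q ++ diamonds k → vars φ ⊆ q

  hintikka-vars k = minterms-vars (map var q ++ diamonds k) (literals-vars k)

  literals-vars k φ∈ with ∈-++⁻ (map var q) φ∈
  literals-vars k φ∈ | inj₁ φ∈ᵛ with _ , v∈ , refl ← ∈-map⁻ var φ∈ᵛ = λ { (here refl) → v∈ }
  literals-vars (suc k) φ∈ | inj₂ φ∈◇
    with _ , _ , _ , χ∈ , refl ← ∈-cartesianProductWith⁻ ◇ (allFin _) (hintikka k) φ∈◇ = hintikka-vars k χ∈

  hintikka-agree : ∀ k {χ : Fm n} → χ ∈ hintikka k → s ⊨ χ → t ⊨ χ → Agree q s t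
  hintikka-agree {n} k {χ} χ∈ s⊨χ t⊨χ = All.zipWith (uncurry T-ext) (atoms s⊨χ t⊨χ , atoms t⊨χ s⊨χ)
    where
    atoms : ∀ {x y : Tree n} → x ⊨ χ → y ⊨ χ → All (λ v → T (valuation x v) → T (valuation y v)) q
    atoms x⊨χ y⊨χ = All.map⁻ (All.++⁻ˡ (map var q) (minterms-agree _ χ∈ x⊨χ y⊨χ))

  -- An i-successor x of s satisfies some χ′ ∈ hintikka k, so s ⊨ ◇ i χ′;
  -- this is one of the literals χ decides, hence t ⊨ ◇ i χ′ as well.
  hintikka-step : ∀ k {χ : Fm n} → χ ∈ hintikka (suc k) → s ⊨ χ → t ⊨ χ → ∀ i →
                  Covers (λ x y → ∃ λ χ′ → χ′ ∈ hintikka k × x ⊨ χ′ × y ⊨ χ′)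
                         (reachable s i) (reachable t i)
  hintikka-step {t = t} k χ∈ s⊨χ t⊨χ i = All.tabulate λ {x} x∈ →
    let χ′ , χ′∈ , x⊨χ′ = hintikka-cover k x
        ◇χ′∈ = ∈-++⁺ʳ (map var q) (∈-cartesianProductWith⁺ ◇ (∈-allFin i) χ′∈)
        t⊨◇χ′ = All.lookup (minterms-agree _ χ∈ s⊨χ t⊨χ) ◇χ′∈ (⊨◇⁺ {A = χ′} (lose x∈ x⊨χ′))
    in Any.map (λ y⊨χ′ → χ′ , χ′∈ , x⊨χ′ , y⊨χ′) (⊨◇⁻ {t = t} {i = i} {A = χ′} t⊨◇χ′)

  hintikka-bisim : ∀ k {χ : Fm n} → χ ∈ hintikka k → s ⊨ χ → t ⊨ χ → Bisim q k s t
  hintikka-bisim zero    χ∈ s⊨χ t⊨χ = hintikka-agree zero χ∈ s⊨χ t⊨χ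
  hintikka-bisim (suc k) χ∈ s⊨χ t⊨χ = hintikka-agree (suc k) χ∈ s⊨χ t⊨χ , λ i →
    All.map (Any.map λ (_ , χ′∈ , x⊨χ′ , y⊨χ′) → hintikka-bisim k χ′∈ x⊨χ′ y⊨χ′)
            (hintikka-step k χ∈ s⊨χ t⊨χ i) ,
    All.map (Any.map λ (_ , χ′∈ , y⊨χ′ , x⊨χ′) → hintikka-bisim k χ′∈ x⊨χ′ y⊨χ′)
            (hintikka-step k χ∈ t⊨χ s⊨χ i)

-- Amalgamation

module Amalgamation (q Vₐ : List ℕ) where

  blend : Tree n → Tree n → ℕ → Bool
  blend x y v with v ∈? Vₐ
  ... | yes _ = valuation x v
  ... | no _  = valuation y v

  amalgam : ℕ → Tree n → Tree n → Tree n
  amalgam zero    x y = node (blend x y) (children y)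
  amalgam (suc l) x y = node (blend x y) λ i →
    map (uncurry (amalgam l)) (filter (uncurry (bisim? q l)) (cartesianProduct (reachable x i) (reachable y i)))

  valuation-amalgam : ∀ l {x y : Tree n} v → valuation (amalgam l x y) v ≡ blend x y v
  valuation-amalgam zero    v = refl
  valuation-amalgam (suc l) v = refl

  variable
    l : ℕ

  data Child (l : ℕ) (x y : Tree n) (i : Fin n) : Tree n → Set where
    child : ∀ {x′ y′} → x′ ∈ reachable x i → y′ ∈ reachable y i → Bisim q l x′ y′ →
            Child l x y i (amalgam l x′ y′)

  ∈-amalgam⁻ : ∀ {x y c : Tree n} → c ∈ children (amalgam (suc l) x y) i → Child l x y i c
  ∈-amalgam⁻ {l = l} {i = i} {x = x} {y = y} c∈
    with (x′ , y′) , xy∈ , refl , x′≈y′ ← ∈-map∘filter⁻ (uncurry (amalgam l)) (uncurry (bisim? q l)) c∈ =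
    let x′∈ , y′∈ = ∈-cartesianProduct⁻ (reachable x i) (reachable y i) xy∈ in child x′∈ y′∈ x′≈y′

  ∈-amalgam⁺ : ∀ {x y x′ y′ : Tree n} → x′ ∈ reachable x i → y′ ∈ reachable y i → Bisim q l x′ y′ →
               amalgam l x′ y′ ∈ children (amalgam (suc l) x y) i
  ∈-amalgam⁺ {l = l} {x′ = x′} {y′} x′∈ y′∈ x′≈y′ =
    ∈-map∘filter⁺ (uncurry (amalgam l)) (uncurry (bisim? q l))
      ((x′ , y′) , ∈-cartesianProduct⁺ x′∈ y′∈ , refl , x′≈y′)

  agreeˡ : ∀ l {x y : Tree n} → Agree Vₐ (amalgam l x y) x
  agreeˡ l {x} {y} = All.tabulate λ {v} v∈ → trans (valuation-amalgam l v) (blendˡ v∈)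
    where
    blendˡ : ∀ {v} → v ∈ Vₐ → blend x y v ≡ valuation x v
    blendˡ {v} v∈ with v ∈? Vₐ
    ... | yes _ = refl
    ... | no v∉ = contradiction v∈ v∉

  amalgam-bisimˡ : ∀ j l {x y : Tree n} → j ≤ l → Bisim q l x y → Bisim Vₐ j (amalgam l x y) x
  amalgam-bisimˡ zero    l       _         _   = agreeˡ l
  amalgam-bisimˡ (suc j) (suc l) {x} {y} (s≤s j≤l) x≈y =
    agreeˡ (suc l) , λ i → All.tabulate (forth i) , All.tabulate (back i)
    where
    forth : ∀ i {c} → c ∈ reachable (amalgam (suc l) x y) i → Any (Bisim Vₐ j c) (reachable x i)
    forth i (here refl) = here (amalgam-bisimˡ j (suc l) (m≤n⇒m≤1+n j≤l) x≈y)
    forth i (there c∈) with child x′∈ _ x′≈y′ ← ∈-amalgam⁻ c∈ =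
      lose x′∈ (amalgam-bisimˡ j l j≤l x′≈y′)
    back : ∀ i {x′} → x′ ∈ reachable x i → Any (λ c → Bisim Vₐ j c x′) (reachable (amalgam (suc l) x y) i)
    back i x′∈ =
      let y′ , y′∈ , x′≈y′ = find (All.lookup (proj₁ (proj₂ x≈y i)) x′∈)
      in there (lose (∈-amalgam⁺ x′∈ y′∈ x′≈y′) (amalgam-bisimˡ j l j≤l x′≈y′))

  module _ {V : List ℕ} (shared : ∀ {v} → v ∈ Vₐ → v ∈ V → v ∈ q) where

    agreeʳ : ∀ l {x y : Tree n} → Bisim q l x y → Agree V (amalgam l x y) y
    agreeʳ l {x} {y} x≈y = All.tabulate λ {v} v∈ → trans (valuation-amalgam l v) (blendʳ v∈)
      where
      blendʳ : ∀ {v} → v ∈ V → blend x y v ≡ valuation y v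
      blendʳ {v} v∈ with v ∈? Vₐ
      ... | yes v∈ₐ = All.lookup (bisim-agree l x≈y) (shared v∈ₐ v∈)
      ... | no _    = refl

    amalgam-bisimʳ : ∀ j l {x y : Tree n} → Bisim q l x y → Bisim V j (amalgam l x y) y
    amalgam-bisimʳ zero    l x≈y = agreeʳ l x≈y
    amalgam-bisimʳ (suc j) zero {x} {y} x≈y =
      agreeʳ zero x≈y , λ i → All.tabulate (forth i) , All.tabulate (back i)
      where
      forth : ∀ i {c} → c ∈ reachable (amalgam zero x y) i → Any (Bisim V j c) (reachable y i)
      forth i (here refl) = here (amalgam-bisimʳ j zero x≈y)
      forth i (there c∈)  = there (lose c∈ (bisim-refl j _))
      back : ∀ i {y′} → y′ ∈ reachable y i → Any (λ c → Bisim V j c y′) (reachable (amalgam zero x y) i)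
      back i (here refl) = here (amalgam-bisimʳ j zero x≈y)
      back i (there c∈)  = there (lose c∈ (bisim-refl j _))
    amalgam-bisimʳ (suc j) (suc l) {x} {y} x≈y =
      agreeʳ (suc l) x≈y , λ i → All.tabulate (forth i) , All.tabulate (back i)
      where
      forth : ∀ i {c} → c ∈ reachable (amalgam (suc l) x y) i → Any (Bisim V j c) (reachable y i)
      forth i (here refl) = here (amalgam-bisimʳ j (suc l) x≈y)
      forth i (there c∈) with child _ y′∈ x′≈y′ ← ∈-amalgam⁻ c∈ =
        lose y′∈ (amalgam-bisimʳ j l x′≈y′)
      back : ∀ i {y′} → y′ ∈ reachable y i → Any (λ c → Bisim V j c y′) (reachable (amalgam (suc l) x y) i)
      back i y′∈ =
        let x′ , x′∈ , x′≈y′ = find (All.lookup (proj₂ (proj₂ x≈y i)) y′∈)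
        in there (lose (∈-amalgam⁺ x′∈ y′∈ x′≈y′) (amalgam-bisimʳ j l x′≈y′))

-- Uniform interpolation

⋁ : List (Fm n) → Fm n
⋁ []      = ⊥'
⋁ (φ ∷ L) = φ ∨' ⋁ L

⊨⋁⁺ : ∀ {φ} {L : List (Fm n)} → φ ∈ L → t ⊨ φ → t ⊨ ⋁ L
⊨⋁⁺ (here refl) t⊨φ = inj₁ t⊨φ
⊨⋁⁺ (there φ∈)  t⊨φ = inj₂ (⊨⋁⁺ φ∈ t⊨φ)

⊨⋁⁻ : ∀ (L : List (Fm n)) → t ⊨ ⋁ L → Any (t ⊨_) L
⊨⋁⁻ (φ ∷ L) (inj₁ t⊨φ) = here t⊨φ
⊨⋁⁻ (φ ∷ L) (inj₂ t⊨⋁) = there (⊨⋁⁻ L t⊨⋁)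

vars-⋁ : ∀ (L : List (Fm n)) → (∀ {φ} → φ ∈ L → vars φ ⊆ V) → vars (⋁ L) ⊆ V
vars-⋁ (φ ∷ L) L⊆ v∈ = Sum.[ L⊆ (here refl) , vars-⋁ L (L⊆ ∘ there) ] (∈-++⁻ (vars φ) v∈)

uniform-interpolant : ∀ (A : Fm n) q → ∃ λ I → vars I ⊆ q × A ⊫ I ×
                      (∀ B → (∀ {v} → v ∈ vars A → v ∈ vars B → v ∈ q) → A ⊫ B → I ⊫ B)
uniform-interpolant {n} A q = ⋁ consistent , I⊆q , A⊫I , I⊫
  where
  open Amalgamation q (vars A)
  d : ℕ
  d = depth A
  consistent? : (χ : Fm n) → Dec (∃ λ t → t ⊨ χ ∧' A)
  consistent? χ = satisfiable? (χ ∧' A)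
  consistent : List (Fm n)
  consistent = filter consistent? (hintikka q d)
  I⊆q : vars (⋁ consistent) ⊆ q
  I⊆q = vars-⋁ consistent (hintikka-vars q d ∘ proj₁ ∘ ∈-filter⁻ consistent?)
  A⊫I : A ⊫ ⋁ consistent
  A⊫I t t⊨A =
    let χ , χ∈ , t⊨χ = hintikka-cover q d t in ⊨⋁⁺ (∈-filter⁺ consistent? χ∈ (t , t⊨χ , t⊨A)) t⊨χ
  I⊫ : ∀ B → (∀ {v} → v ∈ vars A → v ∈ vars B → v ∈ q) → A ⊫ B → ⋁ consistent ⊫ B
  I⊫ B shared A⊫B t t⊨I =
    let χ , χ∈c , t⊨χ = find (⊨⋁⁻ consistent t⊨I)
        χ∈ , s , s⊨χ , s⊨A = ∈-filter⁻ consistent? χ∈c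
        s≈t = hintikka-bisim q d χ∈ s⊨χ t⊨χ
        amalgam⊨A = ⊨-bisim A ≤-refl id (bisim-sym d (amalgam-bisimˡ d d ≤-refl s≈t)) s⊨A
    in ⊨-bisim B ≤-refl id (amalgam-bisimʳ shared (depth B) d s≈t) (A⊫B _ amalgam⊨A)

shared-variables : ∀ (A B : Fm n) {x y z : List ℕ} → Disjoint x z → A ⊆vars x ∪ y → B ⊆vars y ∪ z →
                   ∀ {v} → v ∈ vars A → v ∈ vars B → v ∈ y
shared-variables A B {x = x} {y = y} x∩z A⊆ B⊆ {v} v∈A v∈B
  with ∈-++⁻ x (A⊆ v v∈A) | ∈-++⁻ y (B⊆ v v∈B)
... | inj₂ v∈y | _        = v∈y
... | inj₁ _   | inj₁ v∈y = v∈y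
... | inj₁ v∈x | inj₂ v∈z = contradiction v∈z (x∩z v v∈x)

post-interpolant : (A : Fm n) (p q : List ℕ) → Disjoint q p → A ⊆vars p ∪ q →
  ∃ λ (I : Fm n) → Avoids I p × ([ A ] ⊢ [ I ]) ×
    ((B : Fm n) (r : List ℕ) → Disjoint r q → Disjoint r p → B ⊆vars q ∪ r → [ A ] ⊢ [ B ] → [ I ] ⊢ [ B ])
post-interpolant A p q q∩p A⊆ =
  let I , I⊆q , A⊫I , I⊫ = uniform-interpolant A q
  in I , (λ v v∈I → q∩p v (I⊆q v∈I)) , complete A⊫I , λ B r _ r∩p B⊆ A⊢B →
     complete (I⊫ B (shared-variables A B (λ v v∈p v∈r → r∩p v v∈r v∈p) A⊆ B⊆) (sound-⊫ A⊢B))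

pre-interpolant : (B : Fm n) (q r : List ℕ) → Disjoint q r → B ⊆vars q ∪ r →
  ∃ λ (I : Fm n) → Avoids I r × ([ I ] ⊢ [ B ]) ×
    ((A : Fm n) (p : List ℕ) → Disjoint p q → Disjoint p r → A ⊆vars p ∪ q → [ A ] ⊢ [ B ] → [ A ] ⊢ [ I ])
pre-interpolant B q r q∩r B⊆ =
  let J , J⊆q , ¬B⊫J , J⊫ = uniform-interpolant (¬' B) q
  in ¬' J , (λ v v∈J → q∩r v (J⊆q v∈J)) ,
     complete (λ t t⊭J → decidable-stable (t ⊨? B) (t⊭J ∘ ¬B⊫J t)) ,
     λ A p _ p∩r A⊆ A⊢B → complete λ t t⊨A t⊨J →
       J⊫ (¬' A) (λ v∈B v∈A → shared-variables A B p∩r A⊆ B⊆ v∈A v∈B)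
                 (λ s s⊭B s⊨A → s⊭B (sound-⊫ A⊢B s s⊨A)) t t⊨J t⊨A

corollary4p18 : (n : ℕ) →
    -- pre-interpolants
    ((B : Fm n) (q r : List ℕ) → Disjoint q r → B ⊆vars q ∪ r →
      ∃ λ (I : Fm n) →
        Avoids I r ×
        ([ I ] ⊢ [ B ]) ×
        ((A : Fm n) (p : List ℕ) → Disjoint p q → Disjoint p r → A ⊆vars p ∪ q →
          [ A ] ⊢ [ B ] → [ A ] ⊢ [ I ]))
    ×
    -- post-interpolants
    ((A : Fm n) (p q : List ℕ) → Disjoint q p → A ⊆vars p ∪ q →
      ∃ λ (I : Fm n) →
        Avoids I p ×
        ([ A ] ⊢ [ I ]) ×
        ((B : Fm n) (r : List ℕ) → Disjoint r q → Disjoint r p → B ⊆vars q ∪ r →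
          [ A ] ⊢ [ B ] → [ I ] ⊢ [ B ]))
corollary4p18 n = pre-interpolant , post-interpolant
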